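{- For every $r\in\mathbb{N}$ there exists a colouring $f:\mathbb{N}\to[r+3]$ admitting no monochromatic pair $\{b,a^b\}$ with $a,b\neq1$ and $\log_{(r)}a\le b$.
   Context: $[n]=\{1,\ldots,n\}$. All logarithms are in base 2, and $\log_{(r)}$ denotes the $r$-fold iterated logarithm $\log\log\cdots\log$ ($r$ times). A pair is monochromatic if both elements receive the same colour. -}

module Defs where

open import Data.Nat using (ℕ; zero; suc)
open import Data.Nat.Logarithm using (⌈log₂_⌉)

-- r-fold iterated (ceiling) base-2 logarithm: log₍ r ₎ a = ⌈log₂ ⌈log₂ … a ⌉ … ⌉.
-- For integer b, (log_(r) a ≤ b over the reals) ⇔ (log₍ r ₎ a ≤ b), since
-- ⌈x⌉ ≤ b ⇔ x ≤ b and log is monotone.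
log₍_₎ : ℕ → ℕ → ℕ
log₍ zero ₎ a = a
log₍ suc r ₎ a = ⌈log₂ (log₍ r ₎ a) ⌉

module Submission where

open import Defs
open import Data.Nat using (ℕ; _+_; _^_; _≤_)
open import Data.Fin using (Fin)
open import Data.Product using (Σ)
open import Relation.Binary.PropositionalEquality using (_≢_)

open import Data.Nat
  using (zero; suc; _*_; _∸_; _<_; z≤n; s≤s; s≤s⁻¹; z<s; NonZero; >-nonZero; _≤?_; ⌈_/2⌉; ⌊_/2⌋)
open import Data.Nat.Properties
open import Data.Nat.DivMod using (_%_; _/_; _mod_; m≡m%n+[m/n]*n; m%n<n)
open import Data.Nat.Divisibility using (_∣_; divides; >⇒∤)
open import Data.Nat.Logarithm using (⌈log₂_⌉; ⌈log₂⌉-mono-≤; ⌈log₂⌈n/2⌉⌉≡⌈log₂n⌉∸1)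
open import Data.Fin using (toℕ)
open import Data.Fin.Properties using (toℕ-fromℕ<)
open import Data.Product using (_,_)
open import Data.Sum using (inj₁; inj₂)
open import Relation.Nullary using (yes; no; contradiction)
open import Relation.Binary.PropositionalEquality
  using (_≡_; refl; sym; cong; cong₂; module ≡-Reasoning)

-- Let  tower k = 2↑↑k  (tower 0 = 1, tower (k+1) = 2 ^ tower k) and
-- let the height of n be the least k with n ≤ tower k.  We colour n by its
-- height modulo r + 3.  For a, b ≥ 2 with log₍ r ₎ a ≤ b the height strictly
-- increases from b to a ^ b (since a ^ b ≥ 2 ^ b), but by at most r + 2: if
-- b ≤ tower h then log₍ r ₎ a ≤ tower h gives a ≤ tower (h + r), and any
-- x, y ≤ tower k satisfy x ^ y ≤ tower (k + 2).  Two numbers whose difference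
-- lies strictly between 0 and r + 3 have distinct residues mod r + 3, so the
-- pair {b, a ^ b} is never monochromatic.

n<2^n : ∀ n → n < 2 ^ n
n<2^n zero    = s≤s z≤n
n<2^n (suc n) rewrite +-identityʳ (2 ^ n) = +-mono-≤ (m^n>0 2 n) (n<2^n n)

n+n≤2^n : ∀ n → n + n ≤ 2 ^ n
n+n≤2^n zero    = z≤n
n+n≤2^n (suc n) rewrite +-identityʳ (2 ^ n) = +-mono-≤ (n<2^n n) (n<2^n n)

2^-cancel-≤ : ∀ {m n} → 2 ^ m ≤ 2 ^ n → m ≤ n
2^-cancel-≤ 2^m≤2^n = ≮⇒≥ (λ n<m → <⇒≱ (^-monoʳ-< 2 (s≤s (s≤s z≤n)) n<m) 2^m≤2^n)

-- The self-power of a power of two is bounded by a tower of three more twos: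
-- (2^y)^(2^y) = 2^(y·2^y) and y·2^y ≤ 2^y·2^y = 2^(y+y) ≤ 2^(2^y).
2^y-self-power : ∀ y → (2 ^ y) ^ (2 ^ y) ≤ 2 ^ (2 ^ (2 ^ y))
2^y-self-power y = begin
  X ^ X        ≡⟨ ^-*-assoc 2 y X ⟩
  2 ^ (y * X)  ≤⟨ ^-monoʳ-≤ 2 y*X≤2^X ⟩
  2 ^ (2 ^ X)  ∎
  where
  open ≤-Reasoning
  X : ℕ
  X = 2 ^ y
  y*X≤2^X : y * X ≤ 2 ^ X
  y*X≤2^X = begin
    y * X        ≤⟨ *-monoˡ-≤ X (<⇒≤ (n<2^n y)) ⟩
    X * X        ≡⟨ sym (^-distribˡ-+-* 2 y y) ⟩
    2 ^ (y + y)  ≤⟨ ^-monoʳ-≤ 2 (n+n≤2^n y) ⟩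
    2 ^ X        ∎

-- The ceiling logarithm inverts 2 ^ _ from below: ⌈log₂ x⌉ ≤ y implies x ≤ 2 ^ y.
-- This is the reading of the hypothesis  log₍ r ₎ a ≤ b  as an upper bound on a.
⌈log₂⌉≤⇒≤2^ : ∀ y x → ⌈log₂ x ⌉ ≤ y → x ≤ 2 ^ y
⌈log₂⌉≤⇒≤2^ zero    zero          _   = z≤n
⌈log₂⌉≤⇒≤2^ zero    (suc zero)    _   = ≤-refl
⌈log₂⌉≤⇒≤2^ zero    (suc (suc x)) lg≤0 =
  contradiction (≤-trans (⌈log₂⌉-mono-≤ (s≤s (s≤s (z≤n {x})))) lg≤0) λ ()
⌈log₂⌉≤⇒≤2^ (suc y) x lg≤1+y = begin
  x                  ≡⟨ sym (⌊n/2⌋+⌈n/2⌉≡n x) ⟩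
  ⌊ x /2⌋ + ⌈ x /2⌉  ≤⟨ +-monoˡ-≤ ⌈ x /2⌉ (⌊n/2⌋≤⌈n/2⌉ x) ⟩
  ⌈ x /2⌉ + ⌈ x /2⌉  ≤⟨ +-mono-≤ half≤2^y half≤2^y ⟩
  2 ^ y + 2 ^ y      ≡⟨ cong (2 ^ y +_) (sym (+-identityʳ (2 ^ y))) ⟩
  2 ^ suc y          ∎
  where
  open ≤-Reasoning
  half≤2^y : ⌈ x /2⌉ ≤ 2 ^ y
  half≤2^y = ⌈log₂⌉≤⇒≤2^ y ⌈ x /2⌉
    (≤-trans (≤-reflexive (⌈log₂⌈n/2⌉⌉≡⌈log₂n⌉∸1 x)) (∸-monoˡ-≤ 1 lg≤1+y))

tower : ℕ → ℕ
tower zero    = 1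
tower (suc k) = 2 ^ tower k

tower-pos : ∀ k → 1 ≤ tower k
tower-pos zero    = ≤-refl
tower-pos (suc k) = m^n>0 2 (tower k)

tower-mono : ∀ {j k} → j ≤ k → tower j ≤ tower k
tower-mono {k = k} z≤n = tower-pos k
tower-mono (s≤s j≤k)   = ^-monoʳ-≤ 2 (tower-mono j≤k)

tower-power-bound : ∀ k {x y} → x ≤ tower k → y ≤ tower k → x ^ y ≤ tower (k + 2)
tower-power-bound k {x} {y} x≤T y≤T = begin
  x ^ y          ≤⟨ ^-monoˡ-≤ y x≤T ⟩
  T ^ y          ≤⟨ ^-monoʳ-≤ T {{>-nonZero (tower-pos k)}} y≤T ⟩
  T ^ T          ≤⟨ self-power k ⟩
  tower (2 + k)  ≡⟨ cong tower (+-comm 2 k) ⟩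
  tower (k + 2)  ∎
  where
  open ≤-Reasoning
  T : ℕ
  T = tower k
  self-power : ∀ j → tower j ^ tower j ≤ tower (2 + j)
  self-power zero    = s≤s z≤n
  self-power (suc j) = 2^y-self-power (tower j)

log₍₎-bound : ∀ r k a → log₍ r ₎ a ≤ tower k → a ≤ tower (k + r)
log₍₎-bound zero    k a lg rewrite +-identityʳ k = lg
log₍₎-bound (suc r) k a lg rewrite +-suc k r =
  log₍₎-bound r (suc k) a (⌈log₂⌉≤⇒≤2^ (tower k) (log₍ r ₎ a) lg)

-- The height of n: the least k with n ≤ tower k.  It is computed by walking
-- up from 0; when n + 1 overshoots tower (height n), then n = tower (height n)
-- and n + 1 ≤ 2 ^ n = tower (height n + 1), so the height grows by one.
height : ℕ → ℕ
height zero = 0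
height (suc n) with suc n ≤? tower (height n)
... | yes _ = height n
... | no  _ = suc (height n)

height-covers : ∀ n → n ≤ tower (height n)
height-covers zero = z≤n
height-covers (suc n) with suc n ≤? tower (height n)
... | yes fits = fits
... | no  _    = begin
  suc n                 ≤⟨ s≤s (height-covers n) ⟩
  suc (tower (height n)) ≤⟨ n<2^n (tower (height n)) ⟩
  tower (suc (height n)) ∎
  where open ≤-Reasoning

height-below : ∀ n {j} → j < height n → tower j < n
height-below (suc n) {j} j<h with suc n ≤? tower (height n)
... | yes _    = m<n⇒m<1+n (height-below n j<h)
... | no  n≰T with m≤n⇒m<n∨m≡n (s≤s⁻¹ j<h)
...   | inj₁ j<hn  = m<n⇒m<1+n (height-below n j<hn)
...   | inj₂ refl  = ≰⇒> n≰T

height-least : ∀ n m → n ≤ tower m → height n ≤ m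
height-least n m n≤T = ≮⇒≥ (λ m<h → <⇒≱ (height-below n m<h) n≤T)

height-mono : ∀ {m n} → m ≤ n → height m ≤ height n
height-mono {m} {n} m≤n = height-least m (height n) (≤-trans m≤n (height-covers n))

-- Exponentiating a positive number raises its height: 2 ^ n ≤ tower (k + 1)
-- forces n ≤ tower k.
height-2^ : ∀ n → 1 ≤ n → height n < height (2 ^ n)
height-2^ n 1≤n with height (2 ^ n) | height-covers (2 ^ n)
... | zero  | 2^n≤1 = contradiction (≤-trans (^-monoʳ-≤ 2 {1} 1≤n) 2^n≤1) λ { (s≤s ()) }
... | suc k | 2^n≤T = s≤s (height-least n k (2^-cancel-≤ 2^n≤T))

height-power-lower : ∀ {a b} → 2 ≤ a → 1 ≤ b → height b < height (a ^ b)
height-power-lower {a} {b} 2≤a 1≤b =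
  <-≤-trans (height-2^ b 1≤b) (height-mono (^-monoˡ-≤ b 2≤a))

-- Under  log₍ r ₎ a ≤ b  the height of a ^ b exceeds that of b by at most r + 2:
-- with h = height b we get a, b ≤ tower (h + r), hence a ^ b ≤ tower (h + r + 2).
height-power-upper : ∀ r {a b} → log₍ r ₎ a ≤ b → height (a ^ b) ≤ height b + (r + 2)
height-power-upper r {a} {b} lg = height-least (a ^ b) (h + (r + 2)) (begin
  a ^ b                ≤⟨ tower-power-bound (h + r) a≤T b≤T ⟩
  tower (h + r + 2)    ≡⟨ cong tower (+-assoc h r 2) ⟩
  tower (h + (r + 2))  ∎)
  where
  open ≤-Reasoning
  h : ℕ
  h = height b
  a≤T : a ≤ tower (h + r)
  a≤T = log₍₎-bound r h a (≤-trans lg (height-covers b))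
  b≤T : b ≤ tower (h + r)
  b≤T = ≤-trans (height-covers b) (tower-mono (m≤m+n h r))

-- Residues modulo m separate numbers whose difference is strictly between 0 and m:
-- equal residues would make m divide the difference.
residues-differ : ∀ m .{{_ : NonZero m}} {c d} → c < d → d < c + m → d % m ≢ c % m
residues-differ m {c} {d} c<d d<c+m same =
  >⇒∤ {{>-nonZero (m<n⇒0<n∸m c<d)}} (m<n+o⇒m∸n<o d c d<c+m) m∣d∸c
  where
  open ≡-Reasoning
  m∣d∸c : m ∣ d ∸ c
  m∣d∸c = divides (d / m ∸ c / m) (begin
    d ∸ c                                     ≡⟨ cong₂ _∸_ (m≡m%n+[m/n]*n d m) (m≡m%n+[m/n]*n c m) ⟩
    (d % m + d / m * m) ∸ (c % m + c / m * m) ≡⟨ cong (λ z → (z + d / m * m) ∸ (c % m + c / m * m)) same ⟩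
    (c % m + d / m * m) ∸ (c % m + c / m * m) ≡⟨ [m+n]∸[m+o]≡n∸o (c % m) (d / m * m) (c / m * m) ⟩
    d / m * m ∸ c / m * m                     ≡⟨ sym (*-distribʳ-∸ m (d / m) (c / m)) ⟩
    (d / m ∸ c / m) * m                       ∎)

mod-≡⇒%-≡ : ∀ {m} .{{_ : NonZero m}} {x y} → x mod m ≡ y mod m → x % m ≡ y % m
mod-≡⇒%-≡ {m} {x = x} {y} same = begin
  x % m           ≡⟨ sym (toℕ-fromℕ< (m%n<n x m)) ⟩
  toℕ (x mod m)   ≡⟨ cong toℕ same ⟩
  toℕ (y mod m)   ≡⟨ toℕ-fromℕ< (m%n<n y m) ⟩
  y % m           ∎
  where open ≡-Reasoning

lemma23 : (r : ℕ) → Σ (ℕ → Fin (r + 3)) λ f →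
    (a b : ℕ) → 2 ≤ a → 2 ≤ b → log₍ r ₎ a ≤ b → f b ≢ f (a ^ b)
lemma23 r = colour , no-monochromatic-pair
  where
  instance
    r+3≢0 : NonZero (r + 3)
    r+3≢0 = >-nonZero (<-≤-trans z<s (m≤n+m 3 r))

  colour : ℕ → Fin (r + 3)
  colour n = height n mod (r + 3)

  no-monochromatic-pair : (a b : ℕ) → 2 ≤ a → 2 ≤ b → log₍ r ₎ a ≤ b →
                          colour b ≢ colour (a ^ b)
  no-monochromatic-pair a b 2≤a 2≤b lg same =
    residues-differ (r + 3) rises within (sym (mod-≡⇒%-≡ same))
    where
    rises : height b < height (a ^ b)
    rises = height-power-lower 2≤a (≤-trans (s≤s z≤n) 2≤b)
    within : height (a ^ b) < height b + (r + 3)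
    within = ≤-<-trans (height-power-upper r lg) (+-monoʳ-< (height b) (+-monoʳ-< r ≤-refl))
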